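{- Let $p,q,\ell,n$ be positive integers with $p\le q\le\ell$. Let $N(p,q,\ell,n)$ denote the number of ordered triples $(x,y,z)$ of nonnegative integers with $px+qy+\ell z=n$. Let $u=\gcd(p,q)$ and $A=\{p/u,q/u\}$. For each integer $z$ with $0\le z\le\lfloor n/\ell\rfloor$ and $u\mid (n-z\ell)$, let $a_1(z)$ and $b_1(z)$ be the smallest nonnegative integers satisfying \[ p\,a_1(z)\equiv n-z\ell \pmod q\qquad\text{and}\qquad q\,b_1(z)\equiv n-z\ell\pmod p, \] and let \[ M(z)=\max\Big\{ -1,\ \frac{u}{pq}\big(n-z\ell-p\,a_1(z)-q\,b_1(z)\big)\Big\}. \] Then \[ N(p,q,\ell,n)=\sum_{\substack{0\le z\le\lfloor n/\ell\rfloor\\ u\mid (n-z\ell)}} p_A\!\left(\frac{n-z\ell}{u}\right)=\sum_{\substack{0\le z\le\lfloor n/\ell\rfloor\\ u\mid (n-z\ell)}}\big(1+M(z)\big). \] Furthermore, the set of all nonnegative integer solutions $(x,y,z)$ of $px+qy+\ell z=n$ is the union, over all $z$ with $0\le z\le \lfloor n/\ell\rfloor$ and $u\mid(n-z\ell)$, of the sets \[ \left\{\left(\frac{q}{u}\,i+a_1(z),\ (M(z)-i)\frac{p}{u}+b_1(z),\ z\right):\ i\in\mathbb{Z},\ 0\le i\le M(z)\right\}, \] where for those $z$ with $n-z\ell-p\,a_1(z)-q\,b_1(z)<0$ there are no nonnegative solutions with that value of $z$ (the corresponding set is empty).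
   Context: For a set $A=\{a,b\}$ of relatively prime positive integers and an integer $m\ge0$, $p_A(m)$ denotes the number of partitions of $m$ with all parts in $A$, i.e. the number of pairs $(x,y)$ of nonnegative integers with $ax+by=m$. -}

module Defs where

open import Data.Nat using (ℕ; zero; suc; _+_; _*_; _∸_; _≤_; _≟_; NonZero; ≢-nonZero; ≢-nonZero⁻¹)
open import Data.Nat.GCD using (gcd; gcd[m,n]≢0)
open import Data.Nat.Divisibility using (_∣?_)
import Data.Nat as ℕ
open import Data.Integer as ℤ using (ℤ; +_; _-_)
import Data.Integer.Divisibility as ℤD
open import Data.List using (List; upTo; length; filter; cartesianProduct; foldr; map)
open import Data.Product using (_×_; _,_; proj₁; proj₂)
open import Data.Sum using (inj₁)
open import Data.Nat.Properties using (m*n≢0)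

range : ℕ → List ℕ
range k = upTo (suc k)

_≡_[mod_] : ℤ → ℤ → ℕ → Set
infix 4 _≡_[mod_]
a ≡ b [mod m ] = (+ m) ℤD.∣ (a - b)

-- p_A(m) for A = {a,b}: the number of pairs (x,y) of nonnegative integers with
-- a x + b y = m.  (For a, b ≥ 1 every solution has x, y ≤ m, so enumerating
-- x, y ∈ [0, m] counts all of them.)
pA : ℕ → ℕ → ℕ → ℕ
pA a b m = length (filter (λ xy → a * proj₁ xy + b * proj₂ xy ≟ m)
                          (cartesianProduct (range m) (range m)))

-- N(p,q,ℓ,n): the number of triples (x,y,z) of nonnegative integers with
-- p x + q y + ℓ z = n.  (For p, q, ℓ ≥ 1 every solution has x, y, z ≤ n.)
Ntriples : ℕ → ℕ → ℕ → ℕ → ℕ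
Ntriples p q ℓ n =
  length (filter (λ t → p * proj₁ t + q * proj₁ (proj₂ t) + ℓ * proj₂ (proj₂ t) ≟ n)
                 (cartesianProduct (range n) (cartesianProduct (range n) (range n))))

gcdNZ : ∀ p q → .{{NonZero p}} → NonZero (gcd p q)
gcdNZ p q = ≢-nonZero (gcd[m,n]≢0 p q (inj₁ (≢-nonZero⁻¹ p)))

-- m / gcd p q  (exact division in all uses below)
_/gcd[_,_] : ℕ → (p q : ℕ) → .{{NonZero p}} → ℕ
m /gcd[ p , q ] = ℕ._/_ m (gcd p q) {{gcdNZ p q}}

Zs : (p q ℓ n : ℕ) → .{{NonZero ℓ}} → List ℕ
Zs p q ℓ n = filter (λ z → gcd p q ∣? (n ∸ z * ℓ)) (range (ℕ._/_ n ℓ))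

sumℕ : List ℕ → ℕ
sumℕ = foldr _+_ 0

sumℤ : List ℤ → ℤ
sumℤ = foldr ℤ._+_ (+ 0)

-- M(z) = max{-1, (u/(pq)) (n - zℓ - p a₁ - q b₁)} for given values a₁ = a1z, b₁ = b1z.
-- (When a₁, b₁ are as in the theorem, u·(n - zℓ - p a₁ - q b₁) is divisible by pq,
--  so the floor division below is exact.)
Mval : (p q ℓ n z a1z b1z : ℕ) → .{{NonZero p}} → .{{NonZero q}} → ℤ
Mval p q ℓ n z a1z b1z =
  ℤ.-1ℤ ℤ.⊔ ((+ gcd p q ℤ.* (+ (n ∸ z * ℓ) - + (p * a1z) - + (q * b1z))) ℤ./ℕ (p * q)) {{m*n≢0 p q}}

{-# OPTIONS --safe #-}
-- Fix z, put r = n − zℓ, and let D = r − p a₁ − q b₁.  A solution (x, y) of p x + q y = r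
-- satisfies p x ≡ r (mod q), so by minimality x = a₁ + iQ with Q = q/u, and likewise
-- y = b₁ + jP with P = p/u; hence D = (i + j)·lcm(p, q) ≥ 0.  Conversely, if D ≥ 0 then
-- (a₁, (r − p a₁)/q) is a solution, so D = M·lcm(p, q) for some M ≥ 0, and the solutions are
-- exactly (a₁ + iQ, b₁ + (M − i)P) for 0 ≤ i ≤ M; if D < 0 there are none and M = −1.
-- Since P x + Q y = r/u has the same solutions, both it and the slice z of the triple count
-- have 1 + M solutions; summing over the admissible z gives the counting identities.
module Submission where

open import Defs
open import Data.Integer as ℤ using (ℤ; +_; -[1+_]; _-_)
import Data.Integer.DivMod as ℤ
import Data.Integer.Properties as ℤ
import Data.Integer.Tactic.RingSolver as ℤRing
open import Data.List using (List; []; _∷_; _++_; _∷ʳ_; map; filter; length; cartesianProduct; upTo)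
open import Data.List.Membership.Propositional using (_∈_)
open import Data.List.Membership.Propositional.Properties using (∈-upTo⁻; ∈-filter⁻)
open import Data.List.Properties using (upTo-∷ʳ; length-upTo; map-∘)
open import Data.List.Relation.Unary.Any using (here; there)
open import Data.Nat
  using (ℕ; zero; suc; _+_; _*_; _∸_; _≤_; _<_; _/_; _≟_; z≤n; s≤s; s≤s⁻¹; NonZero; ≢-nonZero; ≢-nonZero⁻¹)
open import Data.Nat.Coprimality using (Coprime; coprime-/gcd; coprime-divisor)
import Data.Nat.Coprimality as Coprime
open import Data.Nat.Divisibility
  using (_∣_; _∣?_; divides; *-cancelˡ-∣; ∣m+n∣m⇒∣n; ∣m∣n⇒∣m+n; ∣m⇒∣m*n; m∣m*n)
open import Data.Nat.DivMod using (m/n*n≡m; m*n/n≡m; m/n*n≤m; m/n≤m; /-monoˡ-≤)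
open import Data.Nat.GCD using (gcd; gcd[m,n]∣m; gcd[m,n]∣n)
open import Data.Nat.Properties
open import Algebra.Properties.CommutativeSemigroup +-commutativeSemigroup using (interchange)
import Algebra.Properties.CommutativeSemigroup *-commutativeSemigroup as *-CS
open import Data.Nat.Tactic.RingSolver using (solve-∀)
open import Data.Product using (_×_; _,_; proj₁; proj₂; ∃-syntax)
open import Function using (_∘_)
open import Function.Bundles using (_⇔_; mk⇔; Equivalence)
open import Function.Construct.Composition using (_⇔-∘_)
open import Relation.Binary.PropositionalEquality
open import Relation.Nullary using (Dec; yes; no; ¬_; contradiction)
open import Relation.Unary using (Decidable)

∑ : {A : Set} → List A → (A → ℕ) → ℕ
∑ xs f = sumℕ (map f xs)

syntax ∑ xs (λ x → e) = ∑[ x ∈ xs ] e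

𝟙 : {P : Set} → Dec P → ℕ
𝟙 (yes _) = 1
𝟙 (no _)  = 0

𝟙-yes : {P : Set} (d : Dec P) → P → 𝟙 d ≡ 1
𝟙-yes (yes _) _  = refl
𝟙-yes (no ¬p) p  = contradiction p ¬p

𝟙-no : {P : Set} (d : Dec P) → ¬ P → 𝟙 d ≡ 0
𝟙-no (yes p) ¬p = contradiction p ¬p
𝟙-no (no _)  _  = refl

private
  variable
    A B : Set

∑-cong : {f g : A → ℕ} (xs : List A) → (∀ {x} → x ∈ xs → f x ≡ g x) → ∑ xs f ≡ ∑ xs g
∑-cong []       _  = refl
∑-cong (x ∷ xs) eq = cong₂ _+_ (eq (here refl)) (∑-cong xs (eq ∘ there))

∑-zero : {f : A → ℕ} (xs : List A) → (∀ {x} → x ∈ xs → f x ≡ 0) → ∑ xs f ≡ 0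
∑-zero []       _  = refl
∑-zero (x ∷ xs) eq = cong₂ _+_ (eq (here refl)) (∑-zero xs (eq ∘ there))

∑-+ : (f g : A → ℕ) (xs : List A) → ∑[ x ∈ xs ] (f x + g x) ≡ ∑ xs f + ∑ xs g
∑-+ f g []       = refl
∑-+ f g (x ∷ xs) = trans (cong (λ t → f x + g x + t) (∑-+ f g xs)) (interchange (f x) (g x) _ _)

∑-*ˡ : (c : ℕ) (f : A → ℕ) (xs : List A) → ∑[ x ∈ xs ] (c * f x) ≡ c * ∑ xs f
∑-*ˡ c f []       = sym (*-zeroʳ c)
∑-*ˡ c f (x ∷ xs) = trans (cong (λ t → c * f x + t) (∑-*ˡ c f xs)) (sym (*-distribˡ-+ c (f x) _))

∑-++ : (f : A → ℕ) (xs ys : List A) → ∑ (xs ++ ys) f ≡ ∑ xs f + ∑ ys f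
∑-++ f []       ys = refl
∑-++ f (x ∷ xs) ys = trans (cong (λ t → f x + t) (∑-++ f xs ys)) (sym (+-assoc (f x) _ _))

∑-const-1 : (xs : List A) → ∑[ _ ∈ xs ] 1 ≡ length xs
∑-const-1 []       = refl
∑-const-1 (_ ∷ xs) = cong suc (∑-const-1 xs)

∑-comm : (f : A → B → ℕ) (xs : List A) (ys : List B) →
         ∑[ x ∈ xs ] ∑[ y ∈ ys ] f x y ≡ ∑[ y ∈ ys ] ∑[ x ∈ xs ] f x y
∑-comm f []       ys = sym (∑-zero ys (λ _ → refl))
∑-comm f (x ∷ xs) ys = trans (cong (λ t → ∑ ys (f x) + t) (∑-comm f xs ys))
                             (sym (∑-+ (f x) (λ y → ∑[ x′ ∈ xs ] f x′ y) ys))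

∑-cartesianProduct : (f : A × B → ℕ) (xs : List A) (ys : List B) →
                     ∑ (cartesianProduct xs ys) f ≡ ∑[ x ∈ xs ] ∑[ y ∈ ys ] f (x , y)
∑-cartesianProduct f []       ys = refl
∑-cartesianProduct f (x ∷ xs) ys = trans (∑-++ f (map (x ,_) ys) (cartesianProduct xs ys))
  (cong₂ _+_ (cong sumℕ (sym (map-∘ ys))) (∑-cartesianProduct f xs ys))

module _ {P : A → Set} (P? : Decidable P) where

  length-filter≡∑𝟙 : (xs : List A) → length (filter P? xs) ≡ ∑[ x ∈ xs ] 𝟙 (P? x)
  length-filter≡∑𝟙 []       = refl
  length-filter≡∑𝟙 (x ∷ xs) with P? x
  ... | yes _ = cong suc (length-filter≡∑𝟙 xs)
  ... | no _  = length-filter≡∑𝟙 xs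

  ∑-filter : (f : A → ℕ) (xs : List A) → ∑ (filter P? xs) f ≡ ∑[ x ∈ xs ] (𝟙 (P? x) * f x)
  ∑-filter f []       = refl
  ∑-filter f (x ∷ xs) with P? x
  ... | yes _ = cong₂ _+_ (sym (+-identityʳ (f x))) (∑-filter f xs)
  ... | no _  = ∑-filter f xs

+∑≡sumℤ : (f : A → ℕ) (g : A → ℤ) (xs : List A) → (∀ {x} → x ∈ xs → + f x ≡ g x) →
          + ∑ xs f ≡ sumℤ (map g xs)
+∑≡sumℤ f g []       _  = refl
+∑≡sumℤ f g (x ∷ xs) eq =
  trans (ℤ.pos-+ (f x) (∑ xs f)) (cong₂ ℤ._+_ (eq (here refl)) (+∑≡sumℤ f g xs (eq ∘ there)))

∑-upTo-suc : (f : ℕ → ℕ) (m : ℕ) → ∑ (upTo (suc m)) f ≡ ∑ (upTo m) f + f m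
∑-upTo-suc f m = begin
  ∑ (upTo (suc m)) f            ≡⟨ cong (λ xs → ∑ xs f) (upTo-∷ʳ m) ⟨
  ∑ (upTo m ∷ʳ m) f             ≡⟨ ∑-++ f (upTo m) (m ∷ []) ⟩
  ∑ (upTo m) f + (f m + 0)      ≡⟨ cong (λ t → ∑ (upTo m) f + t) (+-identityʳ (f m)) ⟩
  ∑ (upTo m) f + f m            ∎
  where open ≡-Reasoning

∑-upTo-𝟙≟ : ∀ m c → c < m → ∑[ y ∈ upTo m ] 𝟙 (y ≟ c) ≡ 1
∑-upTo-𝟙≟ (suc m) c c<1+m = trans (∑-upTo-suc (λ y → 𝟙 (y ≟ c)) m) (last (c ≟ m))
  where
  last : Dec (c ≡ m) → ∑[ y ∈ upTo m ] 𝟙 (y ≟ c) + 𝟙 (m ≟ c) ≡ 1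
  last (yes refl) = cong₂ _+_ (∑-zero (upTo m) (λ y∈ → 𝟙-no (_ ≟ c) (<⇒≢ (∈-upTo⁻ y∈))))
                              (𝟙-yes (m ≟ m) refl)
  last (no c≢m)   = trans (cong₂ _+_ (∑-upTo-𝟙≟ m c (≤∧≢⇒< (s≤s⁻¹ c<1+m) c≢m)) (𝟙-no (m ≟ c) (c≢m ∘ sym)))
                          (+-identityʳ 1)

∑-upTo-vanishing : (f : ℕ → ℕ) (k t : ℕ) → (∀ i → k ≤ i → f i ≡ 0) → ∑ (upTo (t + k)) f ≡ ∑ (upTo k) f
∑-upTo-vanishing f k zero    _   = refl
∑-upTo-vanishing f k (suc t) f≡0 = begin
  ∑ (upTo (suc t + k)) f         ≡⟨ ∑-upTo-suc f (t + k) ⟩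
  ∑ (upTo (t + k)) f + f (t + k) ≡⟨ cong₂ _+_ (∑-upTo-vanishing f k t f≡0) (f≡0 (t + k) (m≤n+m k t)) ⟩
  ∑ (upTo k) f + 0               ≡⟨ +-identityʳ _ ⟩
  ∑ (upTo k) f                   ∎
  where open ≡-Reasoning

module _ {S : ℕ → ℕ → Set} (S? : ∀ x y → Dec (S x y)) where

  pairCount : ℕ → ℕ
  pairCount K = ∑[ x ∈ range K ] ∑[ y ∈ range K ] 𝟙 (S? x y)

  pairCount-empty : (∀ x y → ¬ S x y) → ∀ K → pairCount K ≡ 0
  pairCount-empty ¬S K = ∑-zero (range K) (λ {x} _ → ∑-zero (range K) (λ {y} _ → 𝟙-no (S? x y) (¬S x y)))

  -- 𝟙 (S? x y) is the sum over i of the indicators of (x, y) = (f i, g i); after exchanging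
  -- the summations, each i contributes exactly one pair.
  pairCount-parametrised :
    ∀ K k (f g : ℕ → ℕ) → (∀ {i j} → f i ≡ f j → i ≡ j) → (∀ {x y} → S x y → x ≤ K × y ≤ K) →
    (∀ x y → S x y ⇔ (∃[ i ] (i ≤ k × x ≡ f i × y ≡ g i))) → pairCount K ≡ suc k
  pairCount-parametrised K k f g f-injective bounded S⇔ = begin
    pairCount K
      ≡⟨ ∑-cong (range K) (λ {x} _ → ∑-cong (range K) (λ {y} _ → 𝟙S≡∑hit x y)) ⟩
    ∑[ x ∈ range K ] ∑[ y ∈ range K ] ∑[ i ∈ range k ] hit x y i
      ≡⟨ ∑-cong (range K) (λ {x} _ → ∑-comm (hit x) (range K) (range k)) ⟩
    ∑[ x ∈ range K ] ∑[ i ∈ range k ] ∑[ y ∈ range K ] hit x y i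
      ≡⟨ ∑-comm (λ x i → ∑[ y ∈ range K ] hit x y i) (range K) (range k) ⟩
    ∑[ i ∈ range k ] ∑[ x ∈ range K ] ∑[ y ∈ range K ] hit x y i
      ≡⟨ ∑-cong (range k) (λ i∈ → hits-once (s≤s⁻¹ (∈-upTo⁻ i∈))) ⟩
    ∑[ _ ∈ range k ] 1
      ≡⟨ trans (∑-const-1 (range k)) (length-upTo (suc k)) ⟩
    suc k ∎
    where
    open ≡-Reasoning

    hit : ℕ → ℕ → ℕ → ℕ
    hit x y i = 𝟙 (x ≟ f i) * 𝟙 (y ≟ g i)

    hit-on-diagonal : ∀ i j → hit (f j) (g j) i ≡ 𝟙 (i ≟ j)
    hit-on-diagonal i j with i ≟ j
    ... | yes refl = cong₂ _*_ (𝟙-yes (f i ≟ f i) refl) (𝟙-yes (g i ≟ g i) refl)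
    ... | no i≢j   = cong (_* 𝟙 (g j ≟ g i)) (𝟙-no (f j ≟ f i) (λ fj≡fi → i≢j (f-injective (sym fj≡fi))))

    𝟙S≡∑hit : ∀ x y → 𝟙 (S? x y) ≡ ∑[ i ∈ range k ] hit x y i
    𝟙S≡∑hit x y with S? x y
    ... | yes s with Equivalence.to (S⇔ x y) s
    ...   | j , j≤k , refl , refl = sym (trans (∑-cong (range k) (λ {i} _ → hit-on-diagonal i j))
                                               (∑-upTo-𝟙≟ (suc k) j (s≤s j≤k)))
    𝟙S≡∑hit x y | no ¬s = sym (∑-zero (range k) (λ {i} i∈ → hit≡0 i (s≤s⁻¹ (∈-upTo⁻ i∈))))
      where
      hit≡0 : ∀ i → i ≤ k → hit x y i ≡ 0
      hit≡0 i i≤k with x ≟ f i | y ≟ g i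
      ... | yes x≡ | yes y≡ = contradiction (Equivalence.from (S⇔ x y) (i , i≤k , x≡ , y≡)) ¬s
      ... | yes _  | no _   = refl
      ... | no _   | _      = refl

    hits-once : ∀ {i} → i ≤ k → ∑[ x ∈ range K ] ∑[ y ∈ range K ] hit x y i ≡ 1
    hits-once {i} i≤k = begin
      ∑[ x ∈ range K ] ∑[ y ∈ range K ] (𝟙 (x ≟ f i) * 𝟙 (y ≟ g i))
        ≡⟨ ∑-cong (range K) (λ {x} _ → ∑-*ˡ (𝟙 (x ≟ f i)) (λ y → 𝟙 (y ≟ g i)) (range K)) ⟩
      ∑[ x ∈ range K ] (𝟙 (x ≟ f i) * ∑[ y ∈ range K ] 𝟙 (y ≟ g i))
        ≡⟨ ∑-cong (range K) (λ {x} _ → cong (𝟙 (x ≟ f i) *_) (∑-upTo-𝟙≟ (suc K) (g i) (s≤s gi≤K))) ⟩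
      ∑[ x ∈ range K ] (𝟙 (x ≟ f i) * 1)
        ≡⟨ ∑-cong (range K) (λ _ → *-identityʳ _) ⟩
      ∑[ x ∈ range K ] 𝟙 (x ≟ f i)
        ≡⟨ ∑-upTo-𝟙≟ (suc K) (f i) (s≤s fi≤K) ⟩
      1 ∎
      where
      solution : S (f i) (g i)
      solution = Equivalence.from (S⇔ (f i) (g i)) (i , i≤k , refl , refl)
      fi≤K = proj₁ (bounded solution)
      gi≤K = proj₂ (bounded solution)

pA≡pairCount : ∀ a b m → pA a b m ≡ pairCount (λ x y → a * x + b * y ≟ m) m
pA≡pairCount a b m =
  trans (length-filter≡∑𝟙 (λ xy → a * proj₁ xy + b * proj₂ xy ≟ m) (cartesianProduct (range m) (range m)))
        (∑-cartesianProduct (λ xy → 𝟙 (a * proj₁ xy + b * proj₂ xy ≟ m)) (range m) (range m))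

Ntriples≡∑pairCount : ∀ p q ℓ n →
  Ntriples p q ℓ n ≡ ∑[ z ∈ range n ] pairCount (λ x y → p * x + q * y + ℓ * z ≟ n) n
Ntriples≡∑pairCount p q ℓ n = begin
  Ntriples p q ℓ n
    ≡⟨ length-filter≡∑𝟙 (λ t → E (proj₁ t) (proj₁ (proj₂ t)) (proj₂ (proj₂ t)))
                        (cartesianProduct [0,n] [0,n]²) ⟩
  ∑ (cartesianProduct [0,n] [0,n]²) (λ t → 𝟙 (E (proj₁ t) (proj₁ (proj₂ t)) (proj₂ (proj₂ t))))
    ≡⟨ ∑-cartesianProduct (λ t → 𝟙 (E (proj₁ t) (proj₁ (proj₂ t)) (proj₂ (proj₂ t)))) [0,n] [0,n]² ⟩
  ∑[ x ∈ [0,n] ] ∑ [0,n]² (λ yz → 𝟙 (E x (proj₁ yz) (proj₂ yz)))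
    ≡⟨ ∑-cong [0,n] (λ {x} _ → ∑-cartesianProduct (λ yz → 𝟙 (E x (proj₁ yz) (proj₂ yz))) [0,n] [0,n]) ⟩
  ∑[ x ∈ [0,n] ] ∑[ y ∈ [0,n] ] ∑[ z ∈ [0,n] ] 𝟙 (E x y z)
    ≡⟨ ∑-cong [0,n] (λ {x} _ → ∑-comm (λ y z → 𝟙 (E x y z)) [0,n] [0,n]) ⟩
  ∑[ x ∈ [0,n] ] ∑[ z ∈ [0,n] ] ∑[ y ∈ [0,n] ] 𝟙 (E x y z)
    ≡⟨ ∑-comm (λ x z → ∑[ y ∈ [0,n] ] 𝟙 (E x y z)) [0,n] [0,n] ⟩
  ∑[ z ∈ [0,n] ] ∑[ x ∈ [0,n] ] ∑[ y ∈ [0,n] ] 𝟙 (E x y z) ∎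
  where
  open ≡-Reasoning
  [0,n] = range n
  [0,n]² = cartesianProduct [0,n] [0,n]
  E : ∀ x y z → Dec (p * x + q * y + ℓ * z ≡ n)
  E x y z = p * x + q * y + ℓ * z ≟ n

m≤n/o⇔m*o≤n : ∀ {m n o} .{{_ : NonZero o}} → (m ≤ n / o) ⇔ (m * o ≤ n)
m≤n/o⇔m*o≤n {m} {n} {o} = mk⇔
  (λ m≤n/o → ≤-trans (*-monoˡ-≤ o m≤n/o) (m/n*n≤m n o))
  (λ m*o≤n → subst (_≤ n / o) (m*n/n≡m m o) (/-monoˡ-≤ o m*o≤n))

m+c≡n⇔m≡n∸c : ∀ {m c n} → c ≤ n → (m + c ≡ n) ⇔ (m ≡ n ∸ c)
m+c≡n⇔m≡n∸c {m} {c} c≤n = mk⇔ (λ { refl → sym (m+n∸n≡m m c) }) (λ { refl → m∸n+n≡m c≤n })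

linear-bound : ∀ {a b x y m} .{{_ : NonZero a}} .{{_ : NonZero b}} → a * x + b * y ≡ m → x ≤ m × y ≤ m
linear-bound {a} {b} {x} {y} refl =
  ≤-trans (m≤n*m x a) (m≤m+n (a * x) (b * y)) , ≤-trans (m≤n*m y b) (m≤n+m (b * y) (a * x))

∣+a-+b∣≡b∸a : ∀ {a b} → a ≤ b → ℤ.∣ + a - + b ∣ ≡ b ∸ a
∣+a-+b∣≡b∸a {a} {b} a≤b = trans (cong ℤ.∣_∣ (ℤ.m-n≡m⊖n a b)) (ℤ.∣⊖∣-≤ a≤b)

≡[mod]⇔∣∸ : ∀ {a b q} → a ≤ b → (+ a ≡ + b [mod q ]) ⇔ (q ∣ b ∸ a)
≡[mod]⇔∣∸ a≤b = mk⇔ (subst (_ ∣_) (∣+a-+b∣≡b∸a a≤b)) (subst (_ ∣_) (sym (∣+a-+b∣≡b∸a a≤b)))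

solution-above-least-residue :
  ∀ {p q Q r a x y} → (∀ {d} → q ∣ p * d → Q ∣ d) →
  + (p * a) ≡ + r [mod q ] → (∀ b → + (p * b) ≡ + r [mod q ] → a ≤ b) →
  p * x + q * y ≡ r → ∃[ i ] x ≡ i * Q + a
solution-above-least-residue {p} {q} {Q} {r} {a} {x} {y} cancel a-solves a-least px+qy≡r =
  quotient Q∣x∸a , trans (sym (m∸n+n≡m a≤x)) (cong (_+ a) (equality Q∣x∸a))
  where
  open Data.Nat.Divisibility._∣_
  px≤r : p * x ≤ r
  px≤r = subst (p * x ≤_) px+qy≡r (m≤m+n (p * x) (q * y))
  q∣r∸px : q ∣ r ∸ p * x
  q∣r∸px = divides y (trans (cong (_∸ p * x) (sym px+qy≡r)) (trans (m+n∸m≡n (p * x) (q * y)) (*-comm q y)))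
  a≤x : a ≤ x
  a≤x = a-least x (Equivalence.from (≡[mod]⇔∣∸ px≤r) q∣r∸px)
  pa≤r : p * a ≤ r
  pa≤r = ≤-trans (*-monoʳ-≤ p a≤x) px≤r
  shift : ∀ p q a d y → p * (a + d) + q * y ≡ p * a + (q * y + p * d)
  shift = solve-∀
  r∸pa≡qy+p[x∸a] : r ∸ p * a ≡ q * y + p * (x ∸ a)
  r∸pa≡qy+p[x∸a] = begin
    r ∸ p * a                                 ≡⟨ cong (_∸ p * a) px+qy≡r ⟨
    p * x + q * y ∸ p * a                     ≡⟨ cong (λ t → p * t + q * y ∸ p * a) (m+[n∸m]≡n a≤x) ⟨
    p * (a + (x ∸ a)) + q * y ∸ p * a         ≡⟨ cong (_∸ p * a) (shift p q a (x ∸ a) y) ⟩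
    p * a + (q * y + p * (x ∸ a)) ∸ p * a     ≡⟨ m+n∸m≡n (p * a) _ ⟩
    q * y + p * (x ∸ a)                       ∎
    where open ≡-Reasoning
  Q∣x∸a : Q ∣ x ∸ a
  Q∣x∸a = cancel (∣m+n∣m⇒∣n (subst (q ∣_) r∸pa≡qy+p[x∸a] (Equivalence.to (≡[mod]⇔∣∸ pa≤r) a-solves))
                            (m∣m*n y))

coprime-divisor-scaled : ∀ {A B u d} .{{_ : NonZero u}} → Coprime A B → A * u ∣ (B * u) * d → A ∣ d
coprime-divisor-scaled {A} {B} {u} {d} A⊥B Au∣Bud =
  coprime-divisor A⊥B (*-cancelˡ-∣ u (subst₂ _∣_ (*-comm A u) (regroup B u d) Au∣Bud))
  where
  regroup : ∀ B u d → (B * u) * d ≡ u * (B * d)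
  regroup = solve-∀

r-a-b≡w⇔r≡a+b+w : ∀ {r a b w} → (+ r - + a - + b ≡ + w) ⇔ (r ≡ a + b + w)
r-a-b≡w⇔r≡a+b+w {r} {a} {b} {w} = mk⇔ to from
  where
  regroup : ∀ (r a b : ℤ) → r ≡ (r - a - b) ℤ.+ (a ℤ.+ b)
  regroup = ℤRing.solve-∀
  cancel : ∀ (a b w : ℤ) → (a ℤ.+ b ℤ.+ w) - a - b ≡ w
  cancel = ℤRing.solve-∀
  to : + r - + a - + b ≡ + w → r ≡ a + b + w
  to eq = ℤ.+-injective (begin
    + r                                 ≡⟨ regroup (+ r) (+ a) (+ b) ⟩
    (+ r - + a - + b) ℤ.+ (+ a ℤ.+ + b) ≡⟨ cong₂ ℤ._+_ eq (sym (ℤ.pos-+ a b)) ⟩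
    + w ℤ.+ + (a + b)                   ≡⟨ sym (ℤ.pos-+ w (a + b)) ⟩
    + (w + (a + b))                     ≡⟨ cong +_ (+-comm w (a + b)) ⟩
    + (a + b + w)                       ∎)
    where open ≡-Reasoning
  from : r ≡ a + b + w → + r - + a - + b ≡ + w
  from refl = trans (cong (λ t → t - + a - + b) (trans (ℤ.pos-+ (a + b) w) (cong (ℤ._+ + w) (ℤ.pos-+ a b))))
                    (cancel (+ a) (+ b) (+ w))

i*n<0⇒i≤-1 : ∀ i n → i ℤ.* + n ℤ.< + 0 → i ℤ.≤ ℤ.-1ℤ
i*n<0⇒i≤-1 (+ m)    n i*n<0 with subst (ℤ._< + 0) (sym (ℤ.pos-* m n)) i*n<0
... | ℤ.+<+ ()
i*n<0⇒i≤-1 -[1+ m ] n _ = ℤ.-≤- z≤n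

module LinearEquation (p q : ℕ) .{{_ : NonZero p}} .{{_ : NonZero q}} where

  -- L = P q = lcm(p, q), so that u D / (p q) = D / L.
  u P Q L : ℕ
  u = gcd p q
  P = p /gcd[ p , q ]
  Q = q /gcd[ p , q ]
  L = P * q

  instance
    u≢0 : NonZero u
    u≢0 = gcdNZ p q

  P*u≡p : P * u ≡ p
  P*u≡p = m/n*n≡m (gcd[m,n]∣m p q)

  Q*u≡q : Q * u ≡ q
  Q*u≡q = m/n*n≡m (gcd[m,n]∣n p q)

  instance
    P≢0 : NonZero P
    P≢0 = ≢-nonZero λ P≡0 → ≢-nonZero⁻¹ p (trans (sym P*u≡p) (cong (_* u) P≡0))
    Q≢0 : NonZero Q
    Q≢0 = ≢-nonZero λ Q≡0 → ≢-nonZero⁻¹ q (trans (sym Q*u≡q) (cong (_* u) Q≡0))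

  p*Q≡L : p * Q ≡ L
  p*Q≡L = begin
    p * Q       ≡⟨ cong (_* Q) P*u≡p ⟨
    P * u * Q   ≡⟨ *-assoc P u Q ⟩
    P * (u * Q) ≡⟨ cong (P *_) (trans (*-comm u Q) Q*u≡q) ⟩
    P * q       ∎
    where open ≡-Reasoning

  u*L≡p*q : u * L ≡ p * q
  u*L≡p*q = trans (sym (*-assoc u P q)) (cong (_* q) (trans (*-comm u P) P*u≡p))

  q∣p*d⇒Q∣d : ∀ {d} → q ∣ p * d → Q ∣ d
  q∣p*d⇒Q∣d = coprime-divisor-scaled (Coprime.sym (coprime-/gcd p q))
              ∘ subst₂ (λ a b → a ∣ b * _) (sym Q*u≡q) (sym P*u≡p)

  p∣q*d⇒P∣d : ∀ {d} → p ∣ q * d → P ∣ d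
  p∣q*d⇒P∣d = coprime-divisor-scaled (coprime-/gcd p q)
              ∘ subst₂ (λ a b → a ∣ b * _) (sym P*u≡p) (sym Q*u≡q)

  u∣solution : ∀ {x y r} → p * x + q * y ≡ r → u ∣ r
  u∣solution {x} {y} refl = ∣m∣n⇒∣m+n (∣m⇒∣m*n x (gcd[m,n]∣m p q)) (∣m⇒∣m*n y (gcd[m,n]∣n p q))

  reduced-equation : ∀ {x y r} → u ∣ r → (P * x + Q * y ≡ r /gcd[ p , q ]) ⇔ (p * x + q * y ≡ r)
  reduced-equation {x} {y} {r} u∣r = mk⇔
    (λ eq → trans (sym scale) (trans (cong (_* u) eq) (m/n*n≡m u∣r)))
    (λ eq → *-cancelʳ-≡ _ _ u (trans scale (trans eq (sym (m/n*n≡m u∣r)))))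
    where
    distrib : ∀ P Q x y u → (P * x + Q * y) * u ≡ (P * u) * x + (Q * u) * y
    distrib = solve-∀
    scale : (P * x + Q * y) * u ≡ p * x + q * y
    scale = trans (distrib P Q x y u) (cong₂ (λ a b → a * x + b * y) P*u≡p Q*u≡q)

  module Solutions (r a₁ b₁ : ℕ)
    (a₁-solves : + (p * a₁) ≡ + r [mod q ]) (a₁-least : ∀ a → + (p * a) ≡ + r [mod q ] → a₁ ≤ a)
    (b₁-solves : + (q * b₁) ≡ + r [mod p ]) (b₁-least : ∀ b → + (q * b) ≡ + r [mod p ] → b₁ ≤ b) where

    -- For r = n − zℓ, M is Mval p q ℓ n z a₁ b₁ unfolded.
    D M : ℤ
    D = + r - + (p * a₁) - + (q * b₁)
    M = ℤ.-1ℤ ℤ.⊔ ((+ u ℤ.* D) ℤ./ℕ (p * q)) {{m*n≢0 p q}}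

    OnSegment : ℕ → ℕ → ℕ → Set
    OnSegment k x y = ∃[ i ] (i ≤ k × x ≡ i * Q + a₁ × y ≡ (k ∸ i) * P + b₁)

    D≡w⇔r≡pa₁+qb₁+w : ∀ {w} → (D ≡ + w) ⇔ (r ≡ p * a₁ + q * b₁ + w)
    D≡w⇔r≡pa₁+qb₁+w = r-a-b≡w⇔r≡a+b+w {r} {p * a₁} {q * b₁}

    solution⇒progressions : ∀ {x y} → p * x + q * y ≡ r → ∃[ i ] ∃[ j ] (x ≡ i * Q + a₁ × y ≡ j * P + b₁)
    solution⇒progressions {x} {y} px+qy≡r =
      let i , x≡ = solution-above-least-residue {p} {q} {Q} {r} {a₁} {x} {y} q∣p*d⇒Q∣d a₁-solves a₁-least px+qy≡r
          j , y≡ = solution-above-least-residue {q} {p} {P} {r} {b₁} {y} {x} p∣q*d⇒P∣d b₁-solves b₁-least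
                     (trans (+-comm (q * y) (p * x)) px+qy≡r)
      in i , j , x≡ , y≡

    progressions-value : ∀ i j → p * (i * Q + a₁) + q * (j * P + b₁) ≡ p * a₁ + q * b₁ + (i + j) * L
    progressions-value i j = begin
      p * (i * Q + a₁) + q * (j * P + b₁)             ≡⟨ expand p q a₁ b₁ i j Q P ⟩
      p * a₁ + q * b₁ + (i * (p * Q) + j * (P * q))   ≡⟨ cong (λ t → p * a₁ + q * b₁ + (i * t + j * L)) p*Q≡L ⟩
      p * a₁ + q * b₁ + (i * L + j * L)               ≡⟨ cong (λ t → p * a₁ + q * b₁ + t) (*-distribʳ-+ L i j) ⟨
      p * a₁ + q * b₁ + (i + j) * L                   ∎
      where
      open ≡-Reasoning
      expand : ∀ p q a b i j Q P → p * (i * Q + a) + q * (j * P + b) ≡ p * a + q * b + (i * (p * Q) + j * (P * q))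
      expand = solve-∀

    solution⇒D≡kL : ∀ {x y} → p * x + q * y ≡ r → ∃[ k ] D ≡ + (k * L)
    solution⇒D≡kL {x} {y} px+qy≡r =
      let i , j , x≡ , y≡ = solution⇒progressions px+qy≡r in
      i + j , Equivalence.from (D≡w⇔r≡pa₁+qb₁+w {(i + j) * L})
                (trans (sym px+qy≡r) (trans (cong₂ (λ x y → p * x + q * y) x≡ y≡) (progressions-value i j)))

    D≥0⇒solvable : ∀ {w} → D ≡ + w → ∃[ y ] p * a₁ + q * y ≡ r
    D≥0⇒solvable {w} D≡w =
      quotient q∣r∸pa₁ ,
      trans (cong (λ t → p * a₁ + t) (trans (*-comm q _) (sym (equality q∣r∸pa₁)))) (m+[n∸m]≡n pa₁≤r)
      where
      open Data.Nat.Divisibility._∣_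
      pa₁≤r : p * a₁ ≤ r
      pa₁≤r = subst (p * a₁ ≤_) (sym (Equivalence.to D≡w⇔r≡pa₁+qb₁+w D≡w))
                    (≤-trans (m≤m+n _ _) (m≤m+n _ w))
      q∣r∸pa₁ : q ∣ r ∸ p * a₁
      q∣r∸pa₁ = Equivalence.to (≡[mod]⇔∣∸ pa₁≤r) a₁-solves

    solutions-on-segment : ∀ {k} → D ≡ + (k * L) → ∀ x y → (p * x + q * y ≡ r) ⇔ OnSegment k x y
    solutions-on-segment {k} D≡kL x y = mk⇔ to from
      where
      r≡ : r ≡ p * a₁ + q * b₁ + k * L
      r≡ = Equivalence.to (D≡w⇔r≡pa₁+qb₁+w {k * L}) D≡kL
      to : p * x + q * y ≡ r → OnSegment k x y
      to px+qy≡r = i , subst (i ≤_) i+j≡k (m≤m+n i j) , x≡ , trans y≡ (cong (λ t → t * P + b₁) j≡k∸i)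
        where
        i = proj₁ (solution⇒progressions px+qy≡r)
        j = proj₁ (proj₂ (solution⇒progressions px+qy≡r))
        x≡ = proj₁ (proj₂ (proj₂ (solution⇒progressions px+qy≡r)))
        y≡ = proj₂ (proj₂ (proj₂ (solution⇒progressions px+qy≡r)))
        i+j≡k : i + j ≡ k
        i+j≡k = *-cancelʳ-≡ (i + j) k L {{m*n≢0 P q}} (+-cancelˡ-≡ (p * a₁ + q * b₁) ((i + j) * L) (k * L)
                  (trans (sym (progressions-value i j))
                    (trans (sym (cong₂ (λ x y → p * x + q * y) x≡ y≡)) (trans px+qy≡r r≡))))
        j≡k∸i : j ≡ k ∸ i
        j≡k∸i = trans (sym (m+n∸m≡n i j)) (cong (_∸ i) i+j≡k)
      from : OnSegment k x y → p * x + q * y ≡ r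
      from (i , i≤k , x≡ , y≡) = begin
        p * x + q * y                                     ≡⟨ cong₂ (λ x y → p * x + q * y) x≡ y≡ ⟩
        p * (i * Q + a₁) + q * ((k ∸ i) * P + b₁)         ≡⟨ progressions-value i (k ∸ i) ⟩
        p * a₁ + q * b₁ + (i + (k ∸ i)) * L               ≡⟨ cong (λ t → p * a₁ + q * b₁ + t * L) (m+[n∸m]≡n i≤k) ⟩
        p * a₁ + q * b₁ + k * L                           ≡⟨ r≡ ⟨
        r                                                 ∎
        where open ≡-Reasoning

    M≡k : ∀ {k} → D ≡ + (k * L) → M ≡ + k
    M≡k {k} D≡kL = trans (cong (λ t → ℤ.-1ℤ ℤ.⊔ (t ℤ./ℕ (p * q)) {{m*n≢0 p q}}) uD≡k*pq)
                         (cong (λ t → ℤ.-1ℤ ℤ.⊔ + t) (m*n/n≡m k (p * q) {{m*n≢0 p q}}))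
      where
      uD≡k*pq : + u ℤ.* D ≡ + (k * (p * q))
      uD≡k*pq = begin
        + u ℤ.* D             ≡⟨ cong (+ u ℤ.*_) D≡kL ⟩
        + u ℤ.* + (k * L)     ≡⟨ ℤ.pos-* u (k * L) ⟨
        + (u * (k * L))       ≡⟨ cong +_ (*-CS.x∙yz≈y∙xz u k L) ⟩
        + (k * (u * L))       ≡⟨ cong (λ t → + (k * t)) u*L≡p*q ⟩
        + (k * (p * q))       ∎
        where open ≡-Reasoning

    M≡-1 : D ℤ.< + 0 → M ≡ ℤ.-1ℤ
    M≡-1 D<0 =
      ℤ.i≥j⇒i⊔j≡i (i*n<0⇒i≤-1 _ (p * q) (ℤ.≤-<-trans (ℤ.[n/ℕd]*d≤n (+ u ℤ.* D) (p * q) {{pq≢0}}) uD<0))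
      where
      pq≢0 = m*n≢0 p q
      uD<0 : + u ℤ.* D ℤ.< + 0
      uD<0 = subst (+ u ℤ.* D ℤ.<_) (ℤ.*-zeroʳ (+ u))
               (ℤ.*-monoˡ-<-pos (+ u) {{ℤ.positive (ℤ.+<+ (n≢0⇒n>0 (≢-nonZero⁻¹ u)))}} D<0)

    no-solution-if-D<0 : D ℤ.< + 0 → ∀ x y → p * x + q * y ≢ r
    no-solution-if-D<0 D<0 x y px+qy≡r = +≮0 (subst (ℤ._< + 0) (proj₂ (solution⇒D≡kL px+qy≡r)) D<0)
      where
      +≮0 : ∀ {m} → + m ℤ.≮ + 0
      +≮0 (ℤ.+<+ ())

    data SolutionSet : Set where
      empty   : M ≡ ℤ.-1ℤ → (∀ x y → p * x + q * y ≢ r) → SolutionSet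
      segment : ∀ k → M ≡ + k → (∀ x y → (p * x + q * y ≡ r) ⇔ OnSegment k x y) → SolutionSet

    solution-set : SolutionSet
    solution-set = by-sign-of D refl
      where
      by-sign-of : ∀ d → D ≡ d → SolutionSet
      by-sign-of (+ w) D≡w =
        let k , D≡kL = solution⇒D≡kL (proj₂ (D≥0⇒solvable {w} D≡w)) in
        segment k (M≡k D≡kL) (solutions-on-segment D≡kL)
      by-sign-of -[1+ s ] D≡d = empty (M≡-1 D<0) (no-solution-if-D<0 D<0)
        where
        D<0 : D ℤ.< + 0
        D<0 = subst (ℤ._< + 0) (sym D≡d) ℤ.-<+

    OnSegmentℤ : ℤ → ℕ → ℕ → Set
    OnSegmentℤ m x y = ∃[ i ] (+ i ℤ.≤ m × + x ≡ + Q ℤ.* + i ℤ.+ + a₁ × + y ≡ (m - + i) ℤ.* + P ℤ.+ + b₁)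

    OnSegment⇔OnSegmentℤ : ∀ {k} x y → OnSegment k x y ⇔ OnSegmentℤ (+ k) x y
    OnSegment⇔OnSegmentℤ {k} x y = mk⇔
      (λ (i , i≤k , x≡ , y≡) → i , ℤ.+≤+ i≤k , trans (cong +_ x≡) (x-cast i) ,
                                              trans (cong +_ y≡) (y-cast i i≤k))
      (λ { (i , ℤ.+≤+ i≤k , x≡ , y≡) → i , i≤k , ℤ.+-injective (trans x≡ (sym (x-cast i))) ,
                                                  ℤ.+-injective (trans y≡ (sym (y-cast i i≤k))) })
      where
      x-cast : ∀ i → + (i * Q + a₁) ≡ + Q ℤ.* + i ℤ.+ + a₁
      x-cast i = trans (ℤ.pos-+ (i * Q) a₁) (cong (ℤ._+ + a₁) (trans (cong +_ (*-comm i Q)) (ℤ.pos-* Q i)))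
      y-cast : ∀ i → i ≤ k → + ((k ∸ i) * P + b₁) ≡ (+ k - + i) ℤ.* + P ℤ.+ + b₁
      y-cast i i≤k = trans (ℤ.pos-+ ((k ∸ i) * P) b₁) (cong (ℤ._+ + b₁) (trans (ℤ.pos-* (k ∸ i) P)
                       (cong (ℤ._* + P) (sym (trans (ℤ.m-n≡m⊖n k i) (ℤ.⊖-≥ i≤k))))))

    solutions : ∀ x y → (p * x + q * y ≡ r) ⇔ OnSegmentℤ M x y
    solutions x y with solution-set
    ... | empty M≡-1 none = mk⇔ (λ px+qy≡r → contradiction px+qy≡r (none x y))
                                (λ (i , i≤M , _) → contradiction (subst (+ i ℤ.≤_) M≡-1 i≤M) λ ())
    ... | segment k M≡k seg = subst (λ m → (p * x + q * y ≡ r) ⇔ OnSegmentℤ m x y) (sym M≡k)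
                                (OnSegment⇔OnSegmentℤ x y ⇔-∘ seg x y)

    solution-count : ∀ {S : ℕ → ℕ → Set} (S? : ∀ x y → Dec (S x y)) K →
                     (∀ x y → S x y ⇔ (p * x + q * y ≡ r)) → (∀ {x y} → S x y → x ≤ K × y ≤ K) →
                     + pairCount S? K ≡ + 1 ℤ.+ M
    solution-count S? K S⇔ bounded with solution-set
    ... | empty M≡-1 none =
      trans (cong +_ (pairCount-empty S? (λ x y s → none x y (Equivalence.to (S⇔ x y) s)) K))
            (cong (ℤ._+_ (+ 1)) (sym M≡-1))
    ... | segment k M≡k seg =
      trans (cong +_ (pairCount-parametrised S? K k (λ i → i * Q + a₁) (λ i → (k ∸ i) * P + b₁)
                        (λ {i} {j} e → *-cancelʳ-≡ i j Q (+-cancelʳ-≡ a₁ _ _ e)) bounded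
                        (λ x y → seg x y ⇔-∘ S⇔ x y)))
            (cong (ℤ._+_ (+ 1)) (sym M≡k))

module Triples (p q ℓ n : ℕ) .{{_ : NonZero p}} .{{_ : NonZero q}} .{{_ : NonZero ℓ}} (a₁ b₁ : ℕ → ℕ)
  (a₁-least-residue : ∀ z → z ≤ n / ℓ → gcd p q ∣ (n ∸ z * ℓ) →
    (+ (p * a₁ z) ≡ + (n ∸ z * ℓ) [mod q ]) × (∀ a → + (p * a) ≡ + (n ∸ z * ℓ) [mod q ] → a₁ z ≤ a))
  (b₁-least-residue : ∀ z → z ≤ n / ℓ → gcd p q ∣ (n ∸ z * ℓ) →
    (+ (q * b₁ z) ≡ + (n ∸ z * ℓ) [mod p ]) × (∀ b → + (q * b) ≡ + (n ∸ z * ℓ) [mod p ] → b₁ z ≤ b)) where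

  open LinearEquation p q

  module Slice (z : ℕ) (z≤n/ℓ : z ≤ n / ℓ) (u∣n-zℓ : u ∣ n ∸ z * ℓ) =
    Solutions (n ∸ z * ℓ) (a₁ z) (b₁ z)
      (proj₁ (a₁-least-residue z z≤n/ℓ u∣n-zℓ)) (proj₂ (a₁-least-residue z z≤n/ℓ u∣n-zℓ))
      (proj₁ (b₁-least-residue z z≤n/ℓ u∣n-zℓ)) (proj₂ (b₁-least-residue z z≤n/ℓ u∣n-zℓ))

  Triple? : ∀ z x y → Dec (p * x + q * y + ℓ * z ≡ n)
  Triple? z x y = p * x + q * y + ℓ * z ≟ n

  count : ℕ → ℕ
  count z = pairCount (Triple? z) n

  R : ℕ → ℕ
  R z = (n ∸ z * ℓ) /gcd[ p , q ]

  slice-equation : ∀ {x y z} → z * ℓ ≤ n → (p * x + q * y + ℓ * z ≡ n) ⇔ (p * x + q * y ≡ n ∸ z * ℓ)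
  slice-equation {x} {y} {z} zℓ≤n =
    subst (λ t → (p * x + q * y + t ≡ n) ⇔ (p * x + q * y ≡ n ∸ z * ℓ)) (*-comm z ℓ) (m+c≡n⇔m≡n∸c zℓ≤n)

  solution⇒zℓ≤n : ∀ {x y z} → p * x + q * y + ℓ * z ≡ n → z * ℓ ≤ n
  solution⇒zℓ≤n {x} {y} {z} eq = subst (_≤ n) (*-comm ℓ z) (subst (ℓ * z ≤_) eq (m≤n+m (ℓ * z) _))

  solution⇒admissible : ∀ {x y z} → p * x + q * y + ℓ * z ≡ n → z ≤ n / ℓ × u ∣ n ∸ z * ℓ
  solution⇒admissible eq = Equivalence.from m≤n/o⇔m*o≤n (solution⇒zℓ≤n eq) ,
                           u∣solution (Equivalence.to (slice-equation (solution⇒zℓ≤n eq)) eq)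

  count-inadmissible : ∀ z → ¬ (z ≤ n / ℓ × u ∣ n ∸ z * ℓ) → count z ≡ 0
  count-inadmissible z inadmissible = pairCount-empty (Triple? z) (λ x y → inadmissible ∘ solution⇒admissible) n

  module _ (z : ℕ) (z≤n/ℓ : z ≤ n / ℓ) (u∣n-zℓ : u ∣ n ∸ z * ℓ) where

    open Slice z z≤n/ℓ u∣n-zℓ

    zℓ≤n : z * ℓ ≤ n
    zℓ≤n = Equivalence.to m≤n/o⇔m*o≤n z≤n/ℓ

    count≡1+M : + count z ≡ + 1 ℤ.+ M
    count≡1+M = solution-count (Triple? z) n (λ x y → slice-equation zℓ≤n)
                               (bounded ∘ Equivalence.to (slice-equation zℓ≤n))
      where
      bounded : ∀ {x y} → p * x + q * y ≡ n ∸ z * ℓ → x ≤ n × y ≤ n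
      bounded eq with linear-bound {p} {q} eq
      ... | x≤ , y≤ = ≤-trans x≤ (m∸n≤m n (z * ℓ)) , ≤-trans y≤ (m∸n≤m n (z * ℓ))

    pA≡1+M : + pA P Q (R z) ≡ + 1 ℤ.+ M
    pA≡1+M = trans (cong +_ (pA≡pairCount P Q (R z)))
                   (solution-count _ (R z) (λ x y → reduced-equation u∣n-zℓ) (linear-bound {P} {Q}))

    count≡pA : count z ≡ pA P Q (R z)
    count≡pA = ℤ.+-injective (trans count≡1+M (sym pA≡1+M))

    no-triple-if-D<0 : D ℤ.< + 0 → ∀ x y → p * x + q * y + ℓ * z ≢ n
    no-triple-if-D<0 D<0 x y = no-solution-if-D<0 D<0 x y ∘ Equivalence.to (slice-equation zℓ≤n)

  count≡𝟙*pA : ∀ z → z ≤ n / ℓ → count z ≡ 𝟙 (u ∣? n ∸ z * ℓ) * pA P Q (R z)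
  count≡𝟙*pA z z≤n/ℓ with u ∣? n ∸ z * ℓ
  ... | yes u∣n-zℓ = trans (count≡pA z z≤n/ℓ u∣n-zℓ) (sym (+-identityʳ _))
  ... | no ¬u∣n-zℓ = count-inadmissible z (¬u∣n-zℓ ∘ proj₂)

  Ntriples≡∑pA : Ntriples p q ℓ n ≡ ∑ (Zs p q ℓ n) (λ z → pA P Q (R z))
  Ntriples≡∑pA = begin
    Ntriples p q ℓ n
      ≡⟨ Ntriples≡∑pairCount p q ℓ n ⟩
    ∑ (upTo (suc n)) count
      ≡⟨ cong (λ m → ∑ (upTo m) count) (sym length-split) ⟩
    ∑ (upTo ((n ∸ n / ℓ) + suc (n / ℓ))) count
      ≡⟨ ∑-upTo-vanishing count (suc (n / ℓ)) (n ∸ n / ℓ) beyond ⟩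
    ∑ (range (n / ℓ)) count
      ≡⟨ ∑-cong (range (n / ℓ)) (λ z∈ → count≡𝟙*pA _ (s≤s⁻¹ (∈-upTo⁻ z∈))) ⟩
    ∑[ z ∈ range (n / ℓ) ] (𝟙 (u ∣? n ∸ z * ℓ) * pA P Q (R z))
      ≡⟨ ∑-filter (λ z → u ∣? n ∸ z * ℓ) (λ z → pA P Q (R z)) (range (n / ℓ)) ⟨
    ∑ (Zs p q ℓ n) (λ z → pA P Q (R z)) ∎
    where
    open ≡-Reasoning
    length-split : (n ∸ n / ℓ) + suc (n / ℓ) ≡ suc n
    length-split = trans (+-suc _ _) (cong suc (m∸n+n≡m (m/n≤m n ℓ)))
    beyond : ∀ z → suc (n / ℓ) ≤ z → count z ≡ 0
    beyond z n/ℓ<z = count-inadmissible z (λ (z≤n/ℓ , _) → <⇒≱ n/ℓ<z z≤n/ℓ)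

  ∑pA≡∑[1+M] : + ∑ (Zs p q ℓ n) (λ z → pA P Q (R z))
               ≡ sumℤ (map (λ z → + 1 ℤ.+ Mval p q ℓ n z (a₁ z) (b₁ z)) (Zs p q ℓ n))
  ∑pA≡∑[1+M] = +∑≡sumℤ _ _ (Zs p q ℓ n) λ z∈ →
    let (z∈range , u∣n-zℓ) = ∈-filter⁻ (λ z → u ∣? n ∸ z * ℓ) z∈ in
    pA≡1+M _ (s≤s⁻¹ (∈-upTo⁻ z∈range)) u∣n-zℓ

  triple-solutions : ∀ x y z → (p * x + q * y + ℓ * z ≡ n)
            ⇔ (∃[ z≤n/ℓ ] ∃[ u∣n-zℓ ] Slice.OnSegmentℤ z z≤n/ℓ u∣n-zℓ (Slice.M z z≤n/ℓ u∣n-zℓ) x y)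
  triple-solutions x y z = mk⇔ to from
    where
    to : p * x + q * y + ℓ * z ≡ n → _
    to eq = let (z≤n/ℓ , u∣n-zℓ) = solution⇒admissible eq in
      z≤n/ℓ , u∣n-zℓ , Equivalence.to (Slice.solutions z z≤n/ℓ u∣n-zℓ x y)
                         (Equivalence.to (slice-equation (solution⇒zℓ≤n eq)) eq)
    from : _ → p * x + q * y + ℓ * z ≡ n
    from (z≤n/ℓ , u∣n-zℓ , on-segment) =
      Equivalence.from (slice-equation (Equivalence.to m≤n/o⇔m*o≤n z≤n/ℓ))
        (Equivalence.from (Slice.solutions z z≤n/ℓ u∣n-zℓ x y) on-segment)

theorem2p2 : (p q ℓ n : ℕ) → .{{_ : NonZero p}} → .{{_ : NonZero q}} → .{{_ : NonZero ℓ}} → .{{_ : NonZero n}} →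
  p ≤ q → q ≤ ℓ →
  (a1 b1 : ℕ → ℕ) →
  (∀ z → z ≤ n / ℓ → gcd p q ∣ (n ∸ z * ℓ) →
    (+ (p * a1 z) ≡ + (n ∸ z * ℓ) [mod q ]) × (∀ a → + (p * a) ≡ + (n ∸ z * ℓ) [mod q ] → a1 z ≤ a)) →
  (∀ z → z ≤ n / ℓ → gcd p q ∣ (n ∸ z * ℓ) →
    (+ (q * b1 z) ≡ + (n ∸ z * ℓ) [mod p ]) × (∀ b → + (q * b) ≡ + (n ∸ z * ℓ) [mod p ] → b1 z ≤ b)) →
  (Ntriples p q ℓ n
     ≡ sumℕ (map (λ z → pA (p /gcd[ p , q ]) (q /gcd[ p , q ]) ((n ∸ z * ℓ) /gcd[ p , q ])) (Zs p q ℓ n)))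
  × (+ sumℕ (map (λ z → pA (p /gcd[ p , q ]) (q /gcd[ p , q ]) ((n ∸ z * ℓ) /gcd[ p , q ])) (Zs p q ℓ n))
     ≡ sumℤ (map (λ z → + 1 ℤ.+ Mval p q ℓ n z (a1 z) (b1 z)) (Zs p q ℓ n)))
  × (∀ x y z →
       (p * x + q * y + ℓ * z ≡ n)
       ⇔ ((z ≤ n / ℓ) × (gcd p q ∣ (n ∸ z * ℓ))
          × ∃[ i ] ((+ i ℤ.≤ Mval p q ℓ n z (a1 z) (b1 z))
                    × (+ x ≡ + (q /gcd[ p , q ]) ℤ.* + i ℤ.+ + a1 z)
                    × (+ y ≡ (Mval p q ℓ n z (a1 z) (b1 z) - + i) ℤ.* + (p /gcd[ p , q ]) ℤ.+ + b1 z))))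
  × (∀ z → z ≤ n / ℓ → gcd p q ∣ (n ∸ z * ℓ) →
       (+ (n ∸ z * ℓ) - + (p * a1 z) - + (q * b1 z)) ℤ.< + 0 →
       ∀ x y → p * x + q * y + ℓ * z ≢ n)
theorem2p2 p q ℓ n _ _ a1 b1 a1-least b1-least =
  Ntriples≡∑pA , ∑pA≡∑[1+M] , triple-solutions , no-triple-if-D<0
  where open Triples p q ℓ n a1 b1 a1-least b1-least
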